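{- Let $\mathcal D$ be an abstract system of proof notations and $d\in\mathcal D$ with $\|d\|\ge 2$. Then for all $n\ge 1$ and all $s\ge 2$, $\vartheta_{\mathsf E^n d}(s)\le 2_{n-1}(2\cdot\|d\|)\cdot s$.
   Context: An abstract system of proof notations is a set $\mathcal D$ together with two functions $|\cdot|,\|\cdot\|\colon\mathcal D\to\mathbb N\setminus\{0\}$ ("size" and "height") and a relation $\to\,\subseteq\mathcal D\times\mathcal D$ such that $d\to d'$ implies $\|d'\|<\|d\|$. The cut elimination closure $\mathrm{Ecl}(\mathcal D)$ is defined inductively, with new symbols $\mathsf I,\mathsf R,\mathsf E$: every $d\in\mathcal D$ is in $\mathrm{Ecl}(\mathcal D)$ (with its size and height); if $d,e\in\mathrm{Ecl}(\mathcal D)$ then $\mathsf I d,\ \mathsf R de,\ \mathsf E d\in\mathrm{Ecl}(\mathcal D)$, with $|\mathsf I d|=|d|+1$, $|\mathsf R de|=|d|+|e|+1$, $|\mathsf E d|=|d|+1$, and $\|\mathsf I d\|=\|d\|$, $\|\mathsf R de\|=\|d\|+\|e\|$, $\|\mathsf E d\|=2^{\|d\|}-1$. We write $\mathsf E^n d$ for $\mathsf E$ applied $n$ times to $d$. Size functions: to each $d\in\mathrm{Ecl}(\mathcal D)$ a monotone function $\vartheta_d\colon\mathbb N\to\mathbb N$ is assigned by recursion: $\vartheta_d(s)=s$ for $d\in\mathcal D$; $\vartheta_{\mathsf I d}(s)=\vartheta_d(s)+1$; $\vartheta_{\mathsf R de}(s)=\max\{|d|+1+\vartheta_e(s),\ \vartheta_d(s)+1\}$;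 $\vartheta_{\mathsf E d}(s)=\|d\|\cdot(\vartheta_d(s)+2)$. Iterated exponentiation: $2_0(x)=x$, $2_{n+1}(x)=2^{2_n(x)}$. -}

module Defs where

open import Level using (Level)
open import Data.Nat using (ℕ; zero; suc; _+_; _*_; _∸_; _^_; _≤_; _<_; _⊔_)
open import Relation.Binary.Core using (Rel)

record ProofSystem (a ℓ : Level) : Set (Level.suc (a Level.⊔ ℓ)) where
  field
    D        : Set a
    size     : D → ℕ
    height   : D → ℕ
    size-pos   : ∀ d → 1 ≤ size d
    height-pos : ∀ d → 1 ≤ height d
    _⟶_      : Rel D ℓ
    ⟶-height : ∀ {d d'} → d ⟶ d' → height d' < height d

module _ {a ℓ : Level} (𝒟 : ProofSystem a ℓ) where
  open ProofSystem 𝒟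

  data Ecl : Set a where
    base : D → Ecl
    I    : Ecl → Ecl
    R    : Ecl → Ecl → Ecl
    E    : Ecl → Ecl

  ∣_∣ : Ecl → ℕ
  ∣ base d ∣ = size d
  ∣ I d ∣    = ∣ d ∣ + 1
  ∣ R d e ∣  = ∣ d ∣ + ∣ e ∣ + 1
  ∣ E d ∣    = ∣ d ∣ + 1

  ∥_∥ : Ecl → ℕ
  ∥ base d ∥ = height d
  ∥ I d ∥    = ∥ d ∥
  ∥ R d e ∥  = ∥ d ∥ + ∥ e ∥
  ∥ E d ∥    = 2 ^ ∥ d ∥ ∸ 1

  ϑ : Ecl → ℕ → ℕ
  ϑ (base d) s = s
  ϑ (I d) s    = ϑ d s + 1
  ϑ (R d e) s  = (∣ d ∣ + 1 + ϑ e s) ⊔ (ϑ d s + 1)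
  ϑ (E d) s    = ∥ d ∥ * (ϑ d s + 2)

  Eⁿ : ℕ → Ecl → Ecl
  Eⁿ zero d    = d
  Eⁿ (suc n) d = E (Eⁿ n d)

2↑ : ℕ → ℕ → ℕ
2↑ zero x    = x
2↑ (suc n) x = 2 ^ 2↑ n x

module Submission where

-- Write h = ‖d‖ and A m = 2_m(2h).  We show by induction on m that
--   ϑ_{E^{m+1} d}(s) ≤ A m · s   (for s ≥ 2).
-- Since ϑ_{E y}(s) = ‖y‖·(ϑ_y(s) + 2) and 2 ≤ s, a bound ϑ_y(s) ≤ A·s yields
-- ϑ_{E y}(s) ≤ ‖y‖·(A + 1)·s  (ϑ-E-bound).  For m = 0 apply this with y = d, A = 1.
-- For the step, y = E^{m+1} d, and it remains to see ‖y‖·(A m + 1) ≤ 2^{A m} = A (m+1).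
-- This follows from three facts:
--   * heights grow at most like a tower:  ‖E^{m+1} x‖ < 2_{m+1}(‖x‖)  (height-Eⁿ-<);
--   * the tower at least doubles with its argument: 2·2_m(x) ≤ 2_m(2x)  (tower-double);
--   * the arithmetic estimate  H < 2^k, 2k ≤ A  ⇒  H·(A + 1) ≤ 2^A  (product-bound).

open import Defs
open import Level using (Level)
open import Data.Nat
  using (ℕ; zero; suc; _+_; _*_; _∸_; _^_; _≤_; _<_; _≤′_; ≤′-refl; ≤′-step; z≤n; s≤s)
open import Data.Nat.Properties
open import Relation.Binary.PropositionalEquality using (_≡_; sym; cong)

n<2^n : ∀ n → n < 2 ^ n
n<2^n zero    = s≤s z≤n
n<2^n (suc n) = begin
  suc (suc n)         ≡⟨ +-comm 1 (suc n) ⟩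
  suc n + 1           ≤⟨ +-mono-≤ (n<2^n n) (m^n>0 2 n) ⟩
  2 ^ n + 2 ^ n       ≡⟨ cong (2 ^ n +_) (sym (+-identityʳ (2 ^ n))) ⟩
  2 ^ suc n           ∎
  where open ≤-Reasoning

-- The sharper form 2k ≤ 2^k, needed to compare 2k + 1 with 2^k + 1.
double≤pow : ∀ k → 2 * k ≤ 2 ^ k
double≤pow zero    = z≤n
double≤pow (suc k) = *-monoʳ-≤ 2 (n<2^n k)

mul-suc-bound : ∀ {H P} → H < P → H * suc P ≤ P * P
mul-suc-bound {H} {P} H<P = begin
  H * suc P    ≡⟨ *-suc H P ⟩
  H + H * P    ≤⟨ +-monoˡ-≤ (H * P) (<⇒≤ H<P) ⟩
  suc H * P    ≤⟨ *-monoˡ-≤ P H<P ⟩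
  P * P        ∎
  where open ≤-Reasoning

-- The key estimate: if H < 2^k and 2k ≤ A then H·(A + 1) ≤ 2^A.  The case A = 2k uses
-- mul-suc-bound with P = 2^k; raising A by one adds H ≤ 2^A on the left and doubles the right.
product-bound : ∀ {H k A} → H < 2 ^ k → 2 * k ≤ A → H * suc A ≤ 2 ^ A
product-bound {H} {k} H<2^k 2k≤A = go (≤⇒≤′ 2k≤A)
  where
  open ≤-Reasoning

  2^[2k]≡2^k*2^k : 2 ^ (2 * k) ≡ 2 ^ k * 2 ^ k
  2^[2k]≡2^k*2^k = begin-equality
    2 ^ (k + (k + 0))  ≡⟨ cong (λ j → 2 ^ (k + j)) (+-identityʳ k) ⟩
    2 ^ (k + k)        ≡⟨ ^-distribˡ-+-* 2 k k ⟩
    2 ^ k * 2 ^ k      ∎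

  go : ∀ {A} → 2 * k ≤′ A → H * suc A ≤ 2 ^ A
  go ≤′-refl = begin
    H * suc (2 * k)    ≤⟨ *-monoʳ-≤ H (s≤s (double≤pow k)) ⟩
    H * suc (2 ^ k)    ≤⟨ mul-suc-bound H<2^k ⟩
    2 ^ k * 2 ^ k      ≡⟨ sym 2^[2k]≡2^k*2^k ⟩
    2 ^ (2 * k)        ∎
  go {suc A} (≤′-step 2k≤′A) = begin
    H * suc (suc A)    ≡⟨ *-suc H (suc A) ⟩
    H + H * suc A      ≤⟨ +-mono-≤ H≤2^A (go 2k≤′A) ⟩
    2 ^ A + 2 ^ A      ≡⟨ cong (2 ^ A +_) (sym (+-identityʳ (2 ^ A))) ⟩
    2 ^ suc A          ∎
    where
    k≤A : k ≤ A
    k≤A = ≤-trans (m≤m+n k (k + 0)) (≤′⇒≤ 2k≤′A)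
    H≤2^A : H ≤ 2 ^ A
    H≤2^A = ≤-trans (<⇒≤ H<2^k) (^-monoʳ-≤ 2 k≤A)

tower-pos : ∀ m {x} → 1 ≤ x → 1 ≤ 2↑ m x
tower-pos zero    1≤x = 1≤x
tower-pos (suc m) _   = m^n>0 2 (2↑ m _)

tower-double : ∀ m {x} → 1 ≤ x → 2 * 2↑ m x ≤ 2↑ m (2 * x)
tower-double zero    _   = ≤-refl
tower-double (suc m) {x} 1≤x = ^-monoʳ-≤ 2 (begin
  suc t          ≤⟨ +-monoˡ-≤ t (tower-pos m 1≤x) ⟩
  t + t          ≡⟨ cong (t +_) (sym (+-identityʳ t)) ⟩
  2 * t          ≤⟨ tower-double m 1≤x ⟩
  2↑ m (2 * x)   ∎)
  where
  open ≤-Reasoning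
  t : ℕ
  t = 2↑ m x

module _ {a ℓ : Level} (𝒟 : ProofSystem a ℓ) where

  height-E-< : ∀ y → ∥_∥ 𝒟 (E y) < 2 ^ ∥_∥ 𝒟 y
  height-E-< y = ≤-reflexive (begin-equality
    suc (2 ^ H ∸ 1)   ≡⟨ +-comm 1 (2 ^ H ∸ 1) ⟩
    2 ^ H ∸ 1 + 1     ≡⟨ m∸n+n≡m (m^n>0 2 H) ⟩
    2 ^ H             ∎)
    where
    open ≤-Reasoning
    H : ℕ
    H = ∥_∥ 𝒟 y

  height-Eⁿ-< : ∀ m x → ∥_∥ 𝒟 (Eⁿ 𝒟 (suc m) x) < 2↑ (suc m) (∥_∥ 𝒟 x)
  height-Eⁿ-< zero    x = height-E-< x
  height-Eⁿ-< (suc m) x =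
    <-≤-trans (height-E-< (Eⁿ 𝒟 (suc m) x)) (^-monoʳ-≤ 2 (<⇒≤ (height-Eⁿ-< m x)))

  -- One application of E turns a linear bound ϑ_y(s) ≤ A·s into ϑ_{E y}(s) ≤ ‖y‖·(A + 1)·s,
  -- absorbing the additive constant 2 into s.
  ϑ-E-bound : ∀ y A {s} → 2 ≤ s → ϑ 𝒟 y s ≤ A * s → ϑ 𝒟 (E y) s ≤ ∥_∥ 𝒟 y * suc A * s
  ϑ-E-bound y A {s} 2≤s ϑ≤As = begin
    H * (ϑ 𝒟 y s + 2)   ≤⟨ *-monoʳ-≤ H (+-mono-≤ ϑ≤As 2≤s) ⟩
    H * (A * s + s)     ≡⟨ cong (H *_) (+-comm (A * s) s) ⟩
    H * (suc A * s)     ≡⟨ sym (*-assoc H (suc A) s) ⟩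
    H * suc A * s       ∎
    where
    open ≤-Reasoning
    H : ℕ
    H = ∥_∥ 𝒟 y

  ϑ-Eⁿ-bound : ∀ d {s} → 2 ≤ s → ∀ m →
    ϑ 𝒟 (Eⁿ 𝒟 (suc m) (base d)) s ≤ 2↑ m (2 * ProofSystem.height 𝒟 d) * s
  ϑ-Eⁿ-bound d {s} 2≤s zero = begin
    ϑ 𝒟 (E (base d)) s   ≤⟨ ϑ-E-bound (base d) 1 2≤s (≤-reflexive (sym (*-identityˡ s))) ⟩
    h * 2 * s            ≡⟨ cong (_* s) (*-comm h 2) ⟩
    2 * h * s            ∎
    where
    open ≤-Reasoning
    h : ℕ
    h = ProofSystem.height 𝒟 d
  ϑ-Eⁿ-bound d {s} 2≤s (suc m) = begin
    ϑ 𝒟 (E y) s          ≤⟨ ϑ-E-bound y A 2≤s (ϑ-Eⁿ-bound d 2≤s m) ⟩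
    ∥_∥ 𝒟 y * suc A * s  ≤⟨ *-monoˡ-≤ s ‖y‖[A+1]≤2^A ⟩
    2 ^ A * s            ∎
    where
    open ≤-Reasoning
    h : ℕ
    h = ProofSystem.height 𝒟 d
    1≤h : 1 ≤ h
    1≤h = ProofSystem.height-pos 𝒟 d
    y : Ecl 𝒟
    y = Eⁿ 𝒟 (suc m) (base d)
    A : ℕ
    A = 2↑ m (2 * h)
    ‖y‖[A+1]≤2^A : ∥_∥ 𝒟 y * suc A ≤ 2 ^ A
    ‖y‖[A+1]≤2^A = product-bound {k = 2↑ m h} (height-Eⁿ-< m (base d)) (tower-double m 1≤h)

mainTheorem2 : ∀ {a ℓ : Level} (𝒟 : ProofSystem a ℓ) (d : ProofSystem.D 𝒟) →
    2 ≤ ProofSystem.height 𝒟 d →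
    ∀ (n s : ℕ) → 1 ≤ n → 2 ≤ s →
    ϑ 𝒟 (Eⁿ 𝒟 n (base d)) s ≤ 2↑ (n ∸ 1) (2 * ProofSystem.height 𝒟 d) * s
mainTheorem2 𝒟 d _ (suc m) s _ 2≤s = ϑ-Eⁿ-bound 𝒟 d 2≤s m
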